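{- Let $N\ge 2$ and $n\ge 0$ be integers. Then $$ c_{N,n}=c_{N-1,n}-\frac{N}{(n+1)(N-1)}\sum_{m=0}^{n-1}\binom{n+1}{m}c_{N,m}\,c_{N-1,n-m+1}. $$
   Context: For a positive integer $N$, the hypergeometric Cauchy numbers $c_{N,n}$ ($n\ge 0$) are defined by the formal power series identity $$\frac{1}{{}_2F_1(1,N;N+1;-x)}=\frac{(-1)^{N-1}x^N/N}{\log(1+x)-\sum_{k=1}^{N-1}(-1)^{k-1}x^k/k}=\sum_{n=0}^\infty c_{N,n}\frac{x^n}{n!},$$ where ${}_2F_1(a,b;c;z)=\sum_{n\ge0}\frac{(a)^{(n)}(b)^{(n)}}{(c)^{(n)}}\frac{z^n}{n!}$ is the Gauss hypergeometric function and $(x)^{(n)}=x(x+1)\cdots(x+n-1)$, $(x)^{(0)}=1$. -}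

module Defs where

open import Data.Nat as ℕ using (ℕ; zero; suc; _!; NonZero)
open import Data.Nat.Properties using (m*n≢0; _!≢0)
open import Data.Integer using (+_; -[1+_])
open import Data.Rational using (ℚ; _+_; _*_; -_; _/_; 0ℚ; 1ℚ)
open import Data.List using (List; foldr; map; upTo; zipWith)
open import Data.Vec using (Vec; _∷_; []; head; toList)

Σ< : ℕ → (ℕ → ℚ) → ℚ
Σ< n g = foldr _+_ 0ℚ (map g (upTo n))

rise : ℕ → ℕ → ℕ
rise x zero    = 1
rise x (suc n) = rise x n ℕ.* (x ℕ.+ n)

rise-nz : ∀ x n → NonZero (rise (suc x) n)
rise-nz x zero    = _
rise-nz x (suc n) = m*n≢0 (rise (suc x) n) (suc x ℕ.+ n) {{rise-nz x n}}

-- Coefficient of z^n in 2F1(a,b;c;z) for natural a, b and c ≥ 1 (c = suc c'):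
-- (a)^(n) (b)^(n) / ((c)^(n) n!).
hyp2F1 : ℕ → ℕ → ℕ → ℕ → ℚ
hyp2F1 a b c' n =
  (+ (rise a n ℕ.* rise b n) / (rise (suc c') n ℕ.* n !))
    {{m*n≢0 (rise (suc c') n) (n !) {{rise-nz c' n}} {{n !≢0}}}}

sgn : ℕ → ℚ
sgn zero    = 1ℚ
sgn (suc n) = - sgn n

-- Coefficient of x^n in 2F1(1,N;N+1;-x).
F : ℕ → ℕ → ℚ
F N n = sgn n * hyp2F1 1 N N n

-- Reciprocal of a formal power series f with constant term 1:
-- invUpTo f n = [a_n, …, a_1, a_0] where (Σ a_k x^k)(Σ f_k x^k) = 1, i.e.
-- a_0 = 1 and a_{n+1} = - Σ_{k=1}^{n+1} f_k a_{n+1-k}.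
invUpTo : (ℕ → ℚ) → (n : ℕ) → Vec ℚ (suc n)
invUpTo f zero    = 1ℚ ∷ []
invUpTo f (suc n) =
  let hist = invUpTo f n in
  (- foldr _+_ 0ℚ (zipWith (λ k a → f (suc k) * a) (upTo (suc n)) (toList hist))) ∷ hist

invCoeff : (ℕ → ℚ) → ℕ → ℚ
invCoeff f n = head (invUpTo f n)

-- Hypergeometric Cauchy numbers: 1/2F1(1,N;N+1;-x) = Σ c_{N,n} x^n / n!.
c : ℕ → ℕ → ℚ
c N n = (+ (n !) / 1) * invCoeff (F N) n

denom-nz : ∀ {N} → 2 ℕ.≤ N → ∀ n → NonZero (suc n ℕ.* (N ℕ.∸ 1))
denom-nz (ℕ.s≤s (ℕ.s≤s {n = M} _)) n = m*n≢0 (suc n) (suc M)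

{-# OPTIONS --safe #-}
-- Let f and g be the coefficient sequences of ₂F₁(1,N;N+1;-x) and ₂F₁(1,N-1;N;-x), and A = 1/f,
-- B = 1/g, so that c_{N,n} = n! A_n and c_{N-1,n} = n! B_n. Since f_n = (-1)^n N/(N+n), one has
-- g = 1 - k x f with k = (N-1)/N, hence B = 1 + k x f B. Thus f (A + k x B) = 1 + k x f B = B = f (A B),
-- and cancelling f (whose constant term is 1) gives A B = A + k x B. In the coefficient of x^(n+1)
-- the two top terms of the Cauchy product are A_(n+1) B_0 = A_(n+1) and A_n B_1 = k A_n, which leaves
-- Σ_(m<n) A_m B_(n+1-m) = k (B_n - A_n); multiplying by (n+1)! turns this into the recurrence.
module Submission where

open import Defs
open import Data.Nat as ℕ using (ℕ; zero; suc; _≤_; _<_; _∸_; _!; s≤s; NonZero)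
import Data.Nat.Properties as ℕₚ
open import Data.Nat.Combinatorics using (_C_; nCk≡n!/k![n-k]!; k![n∸k]!∣n!)
open import Data.Nat.DivMod using (m/n*n≡m)
open import Data.Integer as ℤ using (+_)
import Data.Integer.Properties as ℤₚ
open import Data.Rational using (ℚ; _+_; _*_; _-_; -_; _/_; 0ℚ; 1ℚ; toℚᵘ; fromℚᵘ)
open import Data.Rational.Properties
  using ( +-identityˡ; +-identityʳ; +-assoc; *-identityˡ; *-identityʳ; *-assoc; *-distribˡ-+
        ; *-distribʳ-+; *-zeroˡ; *-zeroʳ; +-inverseˡ; neg-distribˡ-*; +-0-group
        ; /-cong; fromℚᵘ-cong; toℚᵘ-fromℚᵘ; toℚᵘ-homo-*; toℚᵘ-injective)
import Data.Rational.Unnormalised as ℚᵘ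
import Data.Rational.Unnormalised.Properties as ℚᵘₚ
open import Data.Rational.Solver using () renaming (module +-*-Solver to ℚ-Solver)
open import Data.Nat.Solver using () renaming (module +-*-Solver to ℕ-Solver)
open import Data.List using (_∷_; foldr; zipWith; applyUpTo; upTo)
open import Data.List.Properties using (map-upTo)
open import Data.Vec using (toList)
open import Data.Sum using (inj₁; inj₂)
open import Algebra.Properties.Group +-0-group using (∙-cancelʳ)
open import Relation.Binary.PropositionalEquality
open ≡-Reasoning

fromℚᵘ-homo-* : ∀ p q → fromℚᵘ (p ℚᵘ.* q) ≡ fromℚᵘ p * fromℚᵘ q
fromℚᵘ-homo-* p q = toℚᵘ-injective (ℚᵘₚ.≃-trans (toℚᵘ-fromℚᵘ (p ℚᵘ.* q)) (ℚᵘₚ.≃-sym (ℚᵘₚ.≃-trans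
  (toℚᵘ-homo-* (fromℚᵘ p) (fromℚᵘ q)) (ℚᵘₚ.*-cong (toℚᵘ-fromℚᵘ p) (toℚᵘ-fromℚᵘ q)))))

*-/ : ∀ a b m n .{{_ : NonZero m}} .{{_ : NonZero n}} →
      (+ a / m) * (+ b / n) ≡ (+ (a ℕ.* b) / (m ℕ.* n)) {{ℕₚ.m*n≢0 m n}}
*-/ a b (suc m) (suc n) =
  trans (sym (fromℚᵘ-homo-* (ℚᵘ.mkℚᵘ (+ a) m) (ℚᵘ.mkℚᵘ (+ b) n))) (/-cong (sym (ℤₚ.pos-* a b)) refl)

/-cross : ∀ a b m n .{{_ : NonZero m}} .{{_ : NonZero n}} →
          a ℕ.* n ≡ b ℕ.* m → + a / m ≡ + b / n
/-cross a b (suc m) (suc n) eq = fromℚᵘ-cong {ℚᵘ.mkℚᵘ (+ a) m} {ℚᵘ.mkℚᵘ (+ b) n} (ℚᵘ.*≡* (begin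
  + a ℤ.* + suc n  ≡˘⟨ ℤₚ.pos-* a (suc n) ⟩
  + (a ℕ.* suc n)  ≡⟨ cong +_ eq ⟩
  + (b ℕ.* suc m)  ≡⟨ ℤₚ.pos-* b (suc m) ⟩
  + b ℤ.* + suc m  ∎))

sumUpTo : (ℕ → ℚ) → ℕ → ℚ
sumUpTo u n = foldr _+_ 0ℚ (applyUpTo u n)

sumUpTo-cong : ∀ n {u v} → (∀ i → i < n → u i ≡ v i) → sumUpTo u n ≡ sumUpTo v n
sumUpTo-cong zero    eq = refl
sumUpTo-cong (suc n) eq = cong₂ _+_ (eq 0 ℕ.z<s) (sumUpTo-cong n (λ i i<n → eq (suc i) (s≤s i<n)))

sumUpTo-0 : ∀ n → sumUpTo (λ _ → 0ℚ) n ≡ 0ℚ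
sumUpTo-0 zero    = refl
sumUpTo-0 (suc n) = trans (+-identityˡ _) (sumUpTo-0 n)

sumUpTo-+ : ∀ n u v → sumUpTo (λ i → u i + v i) n ≡ sumUpTo u n + sumUpTo v n
sumUpTo-+ zero    u v = sym (+-identityˡ 0ℚ)
sumUpTo-+ (suc n) u v = begin
  (u 0 + v 0) + sumUpTo (λ i → u (suc i) + v (suc i)) n
    ≡⟨ cong (_+_ (u 0 + v 0)) (sumUpTo-+ n _ _) ⟩
  (u 0 + v 0) + (U + V)
    ≡⟨ solve 4 (λ a b x y → (a :+ b) :+ (x :+ y) := (a :+ x) :+ (b :+ y)) refl (u 0) (v 0) U V ⟩
  (u 0 + U) + (v 0 + V) ∎
  where
  open ℚ-Solver
  U = sumUpTo (λ i → u (suc i)) n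
  V = sumUpTo (λ i → v (suc i)) n

sumUpTo-* : ∀ n c u → sumUpTo (λ i → c * u i) n ≡ c * sumUpTo u n
sumUpTo-* zero    c u = sym (*-zeroʳ c)
sumUpTo-* (suc n) c u = begin
  c * u 0 + sumUpTo (λ i → c * u (suc i)) n  ≡⟨ cong (_+_ (c * u 0)) (sumUpTo-* n c _) ⟩
  c * u 0 + c * sumUpTo (λ i → u (suc i)) n  ≡˘⟨ *-distribˡ-+ c (u 0) _ ⟩
  c * sumUpTo u (suc n)                      ∎

sumUpTo-suc : ∀ n u → sumUpTo u (suc n) ≡ sumUpTo u n + u n
sumUpTo-suc zero    u = trans (+-identityʳ (u 0)) (sym (+-identityˡ (u 0)))
sumUpTo-suc (suc n) u = begin
  u 0 + sumUpTo (λ i → u (suc i)) (suc n)          ≡⟨ cong (_+_ (u 0)) (sumUpTo-suc n _) ⟩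
  u 0 + (sumUpTo (λ i → u (suc i)) n + u (suc n))  ≡˘⟨ +-assoc (u 0) _ (u (suc n)) ⟩
  sumUpTo u (suc n) + u (suc n)                    ∎

Series : Set
Series = ℕ → ℚ

infixl 7 _⋆_

_⋆_ : Series → Series → Series
(f ⋆ g) n = sumUpTo (λ k → f k * g (n ∸ k)) (suc n)

shift : Series → Series
shift f k = f (suc k)

X·_ : Series → Series
(X· h) zero    = 0ℚ
(X· h) (suc n) = h n

𝟙 : Series
𝟙 zero    = 1ℚ
𝟙 (suc _) = 0ℚ

⋆-zero : ∀ f g → (f ⋆ g) 0 ≡ f 0 * g 0
⋆-zero f g = +-identityʳ (f 0 * g 0)

⋆-cong : ∀ n {f f′ g g′} → (∀ i → f i ≡ f′ i) → (∀ i → i ≤ n → g i ≡ g′ i) →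
         (f ⋆ g) n ≡ (f′ ⋆ g′) n
⋆-cong n f≗f′ g≗g′ =
  sumUpTo-cong (suc n) (λ k _ → cong₂ _*_ (f≗f′ k) (g≗g′ (n ∸ k) (ℕₚ.m∸n≤m n k)))

⋆-distribʳ-+ : ∀ u v h n → ((λ i → u i + v i) ⋆ h) n ≡ (u ⋆ h) n + (v ⋆ h) n
⋆-distribʳ-+ u v h n = trans
  (sumUpTo-cong (suc n) (λ k _ → *-distribʳ-+ (h (n ∸ k)) (u k) (v k)))
  (sumUpTo-+ (suc n) (λ k → u k * h (n ∸ k)) (λ k → v k * h (n ∸ k)))

⋆-distribˡ-+ : ∀ f u v n → (f ⋆ (λ i → u i + v i)) n ≡ (f ⋆ u) n + (f ⋆ v) n
⋆-distribˡ-+ f u v n = trans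
  (sumUpTo-cong (suc n) (λ k _ → *-distribˡ-+ (f k) (u (n ∸ k)) (v (n ∸ k))))
  (sumUpTo-+ (suc n) (λ k → f k * u (n ∸ k)) (λ k → f k * v (n ∸ k)))

*-⋆ : ∀ c u h n → ((λ i → c * u i) ⋆ h) n ≡ c * (u ⋆ h) n
*-⋆ c u h n = trans
  (sumUpTo-cong (suc n) (λ k _ → *-assoc c (u k) (h (n ∸ k))))
  (sumUpTo-* (suc n) c (λ k → u k * h (n ∸ k)))

⋆-* : ∀ c f u n → (f ⋆ (λ i → c * u i)) n ≡ c * (f ⋆ u) n
⋆-* c f u n = trans
  (sumUpTo-cong (suc n) (λ k _ → solve 3 (λ c a b → a :* (c :* b) := c :* (a :* b)) refl c (f k) (u (n ∸ k))))
  (sumUpTo-* (suc n) c (λ k → f k * u (n ∸ k)))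
  where open ℚ-Solver

0-⋆ : ∀ h n → ((λ _ → 0ℚ) ⋆ h) n ≡ 0ℚ
0-⋆ h n = trans
  (sumUpTo-cong (suc n) (λ k _ → *-zeroˡ (h (n ∸ k))))
  (sumUpTo-0 (suc n))

𝟙-⋆ : ∀ h n → (𝟙 ⋆ h) n ≡ h n
𝟙-⋆ h zero    = trans (⋆-zero 𝟙 h) (*-identityˡ (h 0))
𝟙-⋆ h (suc n) = begin
  1ℚ * h (suc n) + ((λ _ → 0ℚ) ⋆ h) n  ≡⟨ cong₂ _+_ (*-identityˡ (h (suc n))) (0-⋆ h n) ⟩
  h (suc n) + 0ℚ                       ≡⟨ +-identityʳ (h (suc n)) ⟩
  h (suc n)                            ∎

⋆-X· : ∀ f h n → (f ⋆ X· h) n ≡ (X· (f ⋆ h)) n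
⋆-X· f h zero          = trans (⋆-zero f (X· h)) (*-zeroʳ (f 0))
⋆-X· f h (suc zero)    = cong (_+_ (f 0 * h 0)) (⋆-X· (shift f) h 0)
⋆-X· f h (suc (suc n)) = cong (_+_ (f 0 * h (suc n))) (⋆-X· (shift f) h (suc n))

⋆-assoc : ∀ f g h n → ((f ⋆ g) ⋆ h) n ≡ (f ⋆ (g ⋆ h)) n
⋆-assoc f g h zero = begin
  (f ⋆ g) 0 * h 0 + 0ℚ  ≡⟨ +-identityʳ _ ⟩
  (f ⋆ g) 0 * h 0       ≡⟨ cong (_* h 0) (⋆-zero f g) ⟩
  f 0 * g 0 * h 0       ≡⟨ *-assoc (f 0) (g 0) (h 0) ⟩
  f 0 * (g 0 * h 0)     ≡˘⟨ cong (f 0 *_) (⋆-zero g h) ⟩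
  f 0 * (g ⋆ h) 0       ≡˘⟨ ⋆-zero f (g ⋆ h) ⟩
  (f ⋆ (g ⋆ h)) 0       ∎
⋆-assoc f g h (suc n) = begin
  (f ⋆ g) 0 * h (suc n) + ((λ i → f 0 * shift g i + (shift f ⋆ g) i) ⋆ h) n
    ≡⟨ cong (_+_ ((f ⋆ g) 0 * h (suc n))) (⋆-distribʳ-+ (λ i → f 0 * shift g i) (shift f ⋆ g) h n) ⟩
  (f ⋆ g) 0 * h (suc n) + (((λ i → f 0 * shift g i) ⋆ h) n + ((shift f ⋆ g) ⋆ h) n)
    ≡⟨ cong₂ (λ a b → a * h (suc n) + b) (⋆-zero f g)
             (cong₂ _+_ (*-⋆ (f 0) (shift g) h n) (⋆-assoc (shift f) g h n)) ⟩
  f 0 * g 0 * h (suc n) + (f 0 * (shift g ⋆ h) n + (shift f ⋆ (g ⋆ h)) n)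
    ≡⟨ solve 5 (λ a b c s t → a :* b :* c :+ (a :* s :+ t) := a :* (b :* c :+ s) :+ t)
             refl (f 0) (g 0) (h (suc n)) ((shift g ⋆ h) n) ((shift f ⋆ (g ⋆ h)) n) ⟩
  f 0 * (g ⋆ h) (suc n) + (shift f ⋆ (g ⋆ h)) n
    ∎
  where open ℚ-Solver

⋆-cancelˡ : ∀ f {u v} → f 0 ≡ 1ℚ → (∀ n → (f ⋆ u) n ≡ (f ⋆ v) n) → ∀ n → u n ≡ v n
⋆-cancelˡ f {u} {v} f₀≡1 f⋆u≗f⋆v n = agree n n ℕₚ.≤-refl
  where
  ⋆-unit-zero : ∀ w → (f ⋆ w) 0 ≡ w 0
  ⋆-unit-zero w = trans (⋆-zero f w) (trans (cong (_* w 0) f₀≡1) (*-identityˡ (w 0)))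

  ⋆-unit-suc : ∀ w n → (f ⋆ w) (suc n) ≡ w (suc n) + (shift f ⋆ w) n
  ⋆-unit-suc w n = cong (_+ (shift f ⋆ w) n) (trans (cong (_* w (suc n)) f₀≡1) (*-identityˡ (w (suc n))))

  agree : ∀ n m → m ≤ n → u m ≡ v m
  agree zero    zero    _ = trans (sym (⋆-unit-zero u)) (trans (f⋆u≗f⋆v 0) (⋆-unit-zero v))
  agree (suc n) m m≤1+n with ℕₚ.m≤n⇒m<n∨m≡n m≤1+n
  ... | inj₁ (s≤s m≤n) = agree n m m≤n
  ... | inj₂ refl      = ∙-cancelʳ ((shift f ⋆ v) n) (u (suc n)) (v (suc n)) (begin
    u (suc n) + (shift f ⋆ v) n  ≡˘⟨ cong (_+_ (u (suc n))) (⋆-cong n {shift f} (λ _ → refl) (agree n)) ⟩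
    u (suc n) + (shift f ⋆ u) n  ≡˘⟨ ⋆-unit-suc u n ⟩
    (f ⋆ u) (suc n)              ≡⟨ f⋆u≗f⋆v (suc n) ⟩
    (f ⋆ v) (suc n)              ≡⟨ ⋆-unit-suc v n ⟩
    v (suc n) + (shift f ⋆ v) n  ∎)

zipWith-applyUpTo : ∀ {A B C : Set} (h : A → B → C) p q n →
                    zipWith h (applyUpTo p n) (applyUpTo q n) ≡ applyUpTo (λ k → h (p k) (q k)) n
zipWith-applyUpTo h p q zero    = refl
zipWith-applyUpTo h p q (suc n) = cong (h (p 0) (q 0) ∷_) (zipWith-applyUpTo h (λ k → p (suc k)) (λ k → q (suc k)) n)

toList-invUpTo : ∀ f n → toList (invUpTo f n) ≡ applyUpTo (λ k → invCoeff f (n ∸ k)) (suc n)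
toList-invUpTo f zero    = refl
toList-invUpTo f (suc n) = cong (invCoeff f (suc n) ∷_) (toList-invUpTo f n)

invCoeff-suc : ∀ f n → invCoeff f (suc n) ≡ - (shift f ⋆ invCoeff f) n
invCoeff-suc f n = cong (λ xs → - foldr _+_ 0ℚ xs) (begin
  zipWith (λ k a → f (suc k) * a) (upTo (suc n)) (toList (invUpTo f n))
    ≡⟨ cong (zipWith (λ k a → f (suc k) * a) (upTo (suc n))) (toList-invUpTo f n) ⟩
  zipWith (λ k a → f (suc k) * a) (upTo (suc n)) (applyUpTo (λ k → invCoeff f (n ∸ k)) (suc n))
    ≡⟨ zipWith-applyUpTo (λ k a → f (suc k) * a) (λ k → k) (λ k → invCoeff f (n ∸ k)) (suc n) ⟩
  applyUpTo (λ k → f (suc k) * invCoeff f (n ∸ k)) (suc n)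
    ∎)

⋆-invCoeff : ∀ f → f 0 ≡ 1ℚ → ∀ n → (f ⋆ invCoeff f) n ≡ 𝟙 n
⋆-invCoeff f f₀≡1 zero    = cong (λ a → a * 1ℚ + 0ℚ) f₀≡1
⋆-invCoeff f f₀≡1 (suc n) = begin
  f 0 * invCoeff f (suc n) + s  ≡⟨ cong₂ (λ a b → a * b + s) f₀≡1 (invCoeff-suc f n) ⟩
  1ℚ * (- s) + s                ≡⟨ cong (_+ s) (*-identityˡ (- s)) ⟩
  - s + s                       ≡⟨ +-inverseˡ s ⟩
  0ℚ                            ∎
  where s = (shift f ⋆ invCoeff f) n

module _ {f g : Series} {k : ℚ}
         (f₀≡1 : f 0 ≡ 1ℚ) (g₀≡1 : g 0 ≡ 1ℚ) (g-suc : ∀ n → g (suc n) ≡ - (k * f n)) where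

  private
    A B : Series
    A = invCoeff f
    B = invCoeff g

  invCoeff-1-kXf-suc : ∀ n → invCoeff g (suc n) ≡ k * (f ⋆ invCoeff g) n
  invCoeff-1-kXf-suc n = begin
    B (suc n)
      ≡⟨ solve 3 (λ b k s → b := (b :+ (:- k) :* s) :+ k :* s) refl (B (suc n)) k s ⟩
    (B (suc n) + (- k) * s) + k * s
      ≡⟨ cong (_+ k * s) g⋆B-suc ⟩
    0ℚ + k * s
      ≡⟨ +-identityˡ (k * s) ⟩
    k * s ∎
    where
    open ℚ-Solver
    s = (f ⋆ B) n
    shift-g≗-k*f : ∀ i → g (suc i) ≡ (- k) * f i
    shift-g≗-k*f i = trans (g-suc i) (neg-distribˡ-* k (f i))

    g⋆B-suc : B (suc n) + (- k) * s ≡ 0ℚ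
    g⋆B-suc = begin
      B (suc n) + (- k) * s
        ≡˘⟨ cong₂ _+_ (trans (cong (_* B (suc n)) g₀≡1) (*-identityˡ (B (suc n)))) (*-⋆ (- k) f B n) ⟩
      g 0 * B (suc n) + ((λ i → (- k) * f i) ⋆ B) n
        ≡˘⟨ cong (_+_ (g 0 * B (suc n))) (⋆-cong n {shift g} {λ i → (- k) * f i} {B} shift-g≗-k*f (λ _ _ → refl)) ⟩
      (g ⋆ B) (suc n)
        ≡⟨ ⋆-invCoeff g g₀≡1 (suc n) ⟩
      0ℚ ∎

  invCoeff-⋆-invCoeff : ∀ n → (invCoeff f ⋆ invCoeff g) n ≡ invCoeff f n + k * (X· invCoeff g) n
  invCoeff-⋆-invCoeff = ⋆-cancelˡ f f₀≡1 (λ n → trans (f⋆A⋆B n) (sym (f⋆[A+kX·B] n)))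
    where
    f⋆A⋆B : ∀ n → (f ⋆ (A ⋆ B)) n ≡ B n
    f⋆A⋆B n = begin
      (f ⋆ (A ⋆ B)) n  ≡˘⟨ ⋆-assoc f A B n ⟩
      ((f ⋆ A) ⋆ B) n  ≡⟨ ⋆-cong n {f ⋆ A} {𝟙} {B} (⋆-invCoeff f f₀≡1) (λ _ _ → refl) ⟩
      (𝟙 ⋆ B) n        ≡⟨ 𝟙-⋆ B n ⟩
      B n              ∎

    𝟙+kX·[f⋆B] : ∀ n → 𝟙 n + k * (X· (f ⋆ B)) n ≡ B n
    𝟙+kX·[f⋆B] zero    = trans (cong (_+_ 1ℚ) (*-zeroʳ k)) (+-identityʳ 1ℚ)
    𝟙+kX·[f⋆B] (suc n) = trans (+-identityˡ _) (sym (invCoeff-1-kXf-suc n))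

    f⋆[A+kX·B] : ∀ n → (f ⋆ (λ i → A i + k * (X· B) i)) n ≡ B n
    f⋆[A+kX·B] n = begin
      (f ⋆ (λ i → A i + k * (X· B) i)) n  ≡⟨ ⋆-distribˡ-+ f A (λ i → k * (X· B) i) n ⟩
      (f ⋆ A) n + (f ⋆ (λ i → k * (X· B) i)) n  ≡⟨ cong₂ _+_ (⋆-invCoeff f f₀≡1 n) (⋆-* k f (X· B) n) ⟩
      𝟙 n + k * (f ⋆ X· B) n                  ≡⟨ cong (λ t → 𝟙 n + k * t) (⋆-X· f B n) ⟩
      𝟙 n + k * (X· (f ⋆ B)) n                ≡⟨ 𝟙+kX·[f⋆B] n ⟩
      B n                                     ∎

  sumUpTo-invCoeff-⋆-invCoeff : ∀ n →
    sumUpTo (λ m → invCoeff f m * invCoeff g (suc n ∸ m)) n ≡ k * (invCoeff g n - invCoeff f n)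
  sumUpTo-invCoeff-⋆-invCoeff n = begin
    S
      ≡⟨ solve 4 (λ s a k a′ → s := ((s :+ a :* k) :+ a′ :* con 1ℚ) :- a :* k :- a′) refl S (A n) k (A (suc n)) ⟩
    ((S + A n * k) + A (suc n) * 1ℚ) - A n * k - A (suc n)
      ≡⟨ cong (λ t → t - A n * k - A (suc n)) coefficient-suc ⟩
    (A (suc n) + k * B n) - A n * k - A (suc n)
      ≡⟨ solve 4 (λ a′ k b a → (a′ :+ k :* b) :- a :* k :- a′ := k :* (b :- a)) refl (A (suc n)) k (B n) (A n) ⟩
    k * (B n - A n) ∎
    where
    open ℚ-Solver
    u : ℕ → ℚ
    u m = A m * B (suc n ∸ m)
    S = sumUpTo u n

    B₁≡k : B 1 ≡ k
    B₁≡k = begin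
      B 1                ≡⟨ invCoeff-1-kXf-suc 0 ⟩
      k * (f ⋆ B) 0      ≡⟨ cong (k *_) (trans (⋆-zero f B) (trans (cong (_* 1ℚ) f₀≡1) (*-identityˡ 1ℚ))) ⟩
      k * 1ℚ             ≡⟨ *-identityʳ k ⟩
      k                  ∎

    coefficient-suc : (S + A n * k) + A (suc n) * 1ℚ ≡ A (suc n) + k * B n
    coefficient-suc = begin
      (S + A n * k) + A (suc n) * 1ℚ
        ≡˘⟨ cong₂ (λ a b → (S + A n * a) + A (suc n) * b) (trans (cong B (ℕₚ.m+n∸n≡m 1 n)) B₁≡k) (cong B (ℕₚ.n∸n≡0 n)) ⟩
      (S + u n) + u (suc n)
        ≡˘⟨ cong (_+ u (suc n)) (sumUpTo-suc n u) ⟩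
      sumUpTo u (suc n) + u (suc n)
        ≡˘⟨ sumUpTo-suc (suc n) u ⟩
      (A ⋆ B) (suc n)
        ≡⟨ invCoeff-⋆-invCoeff (suc n) ⟩
      A (suc n) + k * B n ∎

rise-1 : ∀ n → rise 1 n ≡ n !
rise-1 zero    = refl
rise-1 (suc n) = trans (cong (ℕ._* suc n) (rise-1 n)) (ℕₚ.*-comm (n !) (suc n))

rise-suc : ∀ a n → rise a n ℕ.* (a ℕ.+ n) ≡ a ℕ.* rise (suc a) n
rise-suc a zero    = trans (ℕₚ.*-identityˡ (a ℕ.+ 0)) (trans (ℕₚ.+-identityʳ a) (sym (ℕₚ.*-identityʳ a)))
rise-suc a (suc n) = begin
  rise a n ℕ.* (a ℕ.+ n) ℕ.* (a ℕ.+ suc n)  ≡⟨ cong₂ ℕ._*_ (rise-suc a n) (ℕₚ.+-suc a n) ⟩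
  a ℕ.* rise (suc a) n ℕ.* (suc a ℕ.+ n)    ≡⟨ ℕₚ.*-assoc a (rise (suc a) n) (suc a ℕ.+ n) ⟩
  a ℕ.* rise (suc a) (suc n)                ∎

hyp2F1-1-N-N : ∀ N n → hyp2F1 1 (suc N) (suc N) n ≡ + suc N / (suc N ℕ.+ n)
hyp2F1-1-N-N N n =
  /-cross (rise 1 n ℕ.* rise (suc N) n) (suc N) (rise (2 ℕ.+ N) n ℕ.* n !) (suc N ℕ.+ n)
    {{ℕₚ.m*n≢0 (rise (2 ℕ.+ N) n) (n !) {{rise-nz (suc N) n}} {{ℕₚ._!≢0 n}}}} (begin
  rise 1 n ℕ.* rise (suc N) n ℕ.* (suc N ℕ.+ n)
    ≡⟨ ℕₚ.*-assoc (rise 1 n) _ _ ⟩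
  rise 1 n ℕ.* (rise (suc N) n ℕ.* (suc N ℕ.+ n))
    ≡⟨ cong₂ ℕ._*_ (rise-1 n) (rise-suc (suc N) n) ⟩
  n ! ℕ.* (suc N ℕ.* rise (2 ℕ.+ N) n)
    ≡⟨ solve 3 (λ f a r → f :* (a :* r) := a :* (r :* f)) refl (n !) (suc N) (rise (2 ℕ.+ N) n) ⟩
  suc N ℕ.* (rise (2 ℕ.+ N) n ℕ.* n !) ∎)
  where open ℕ-Solver

F-suc : ∀ N n → F (suc N) (suc n) ≡ - ((+ suc N / (2 ℕ.+ N)) * F (2 ℕ.+ N) n)
F-suc N n = begin
  (- sgn n) * hyp2F1 1 (suc N) (suc N) (suc n)
    ≡⟨ cong ((- sgn n) *_) (trans (hyp2F1-1-N-N N (suc n)) (sym k*[N+1]/[N+1+n])) ⟩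
  (- sgn n) * (k * (+ (2 ℕ.+ N) / (2 ℕ.+ N ℕ.+ n)))
    ≡˘⟨ cong (λ t → (- sgn n) * (k * t)) (hyp2F1-1-N-N (suc N) n) ⟩
  (- sgn n) * (k * hyp2F1 1 (2 ℕ.+ N) (2 ℕ.+ N) n)
    ≡⟨ solve 3 (λ s k h → (:- s) :* (k :* h) := :- (k :* (s :* h))) refl (sgn n) k (hyp2F1 1 (2 ℕ.+ N) (2 ℕ.+ N) n) ⟩
  - (k * F (2 ℕ.+ N) n) ∎
  where
  open ℚ-Solver
  k = + suc N / (2 ℕ.+ N)
  k*[N+1]/[N+1+n] : k * (+ (2 ℕ.+ N) / (2 ℕ.+ N ℕ.+ n)) ≡ + suc N / (suc N ℕ.+ suc n)
  k*[N+1]/[N+1+n] = trans (*-/ (suc N) (2 ℕ.+ N) (2 ℕ.+ N) (2 ℕ.+ N ℕ.+ n))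
    (/-cross (suc N ℕ.* (2 ℕ.+ N)) (suc N) ((2 ℕ.+ N) ℕ.* (2 ℕ.+ N ℕ.+ n)) (suc N ℕ.+ suc n) (trans
      (cong (suc N ℕ.* (2 ℕ.+ N) ℕ.*_) (ℕₚ.+-suc (suc N) n))
      (ℕₚ.*-assoc (suc N) (2 ℕ.+ N) (2 ℕ.+ N ℕ.+ n))))

nCk*k!*[n∸k]!≡n! : ∀ {n k} → k ≤ n → (n C k) ℕ.* k ! ℕ.* (n ∸ k) ! ≡ n !
nCk*k!*[n∸k]!≡n! {n} {k} k≤n = begin
  (n C k) ℕ.* k ! ℕ.* (n ∸ k) !
    ≡⟨ ℕₚ.*-assoc (n C k) (k !) ((n ∸ k) !) ⟩
  (n C k) ℕ.* (k ! ℕ.* (n ∸ k) !)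
    ≡⟨ cong (ℕ._* (k ! ℕ.* (n ∸ k) !)) (nCk≡n!/k![n-k]! k≤n) ⟩
  (n ! ℕ./ (k ! ℕ.* (n ∸ k) !)) {{k!*[n∸k]!≢0}} ℕ.* (k ! ℕ.* (n ∸ k) !)
    ≡⟨ m/n*n≡m {{k!*[n∸k]!≢0}} (k![n∸k]!∣n! k≤n) ⟩
  n ! ∎
  where k!*[n∸k]!≢0 = ℕₚ._!*_!≢0 k (n ∸ k)

binomial-*-factorials : ∀ {n k} → k ≤ n → ∀ a b →
  (+ (n C k) / 1) * ((+ (k !) / 1) * a) * ((+ ((n ∸ k) !) / 1) * b) ≡ (+ (n !) / 1) * (a * b)
binomial-*-factorials {n} {k} k≤n a b = begin
  u * (v * a) * (w * b)
    ≡⟨ solve 5 (λ u v a w b → u :* (v :* a) :* (w :* b) := u :* v :* w :* (a :* b)) refl u v a w b ⟩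
  u * v * w * (a * b)
    ≡⟨ cong (_* (a * b)) (trans (cong (_* w) (*-/ (n C k) (k !) 1 1)) (*-/ ((n C k) ℕ.* k !) ((n ∸ k) !) 1 1)) ⟩
  (+ ((n C k) ℕ.* k ! ℕ.* (n ∸ k) !) / 1) * (a * b)
    ≡⟨ cong (λ t → (+ t / 1) * (a * b)) (nCk*k!*[n∸k]!≡n! k≤n) ⟩
  (+ (n !) / 1) * (a * b) ∎
  where
  open ℚ-Solver
  u = + (n C k) / 1
  v = + (k !) / 1
  w = + ((n ∸ k) !) / 1

Σ<-binomial-factorials : ∀ n (a b : Series) →
  Σ< n (λ m → (+ (suc n C m) / 1) * ((+ (m !) / 1) * a m) * ((+ ((n ∸ m ℕ.+ 1) !) / 1) * b (n ∸ m ℕ.+ 1)))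
    ≡ (+ (suc n !) / 1) * sumUpTo (λ m → a m * b (suc n ∸ m)) n
Σ<-binomial-factorials n a b = begin
  Σ< n G                                          ≡⟨ cong (foldr _+_ 0ℚ) (map-upTo G n) ⟩
  sumUpTo G n                                     ≡⟨ sumUpTo-cong n term ⟩
  sumUpTo (λ m → β * (a m * b (suc n ∸ m))) n     ≡⟨ sumUpTo-* n β (λ m → a m * b (suc n ∸ m)) ⟩
  β * sumUpTo (λ m → a m * b (suc n ∸ m)) n       ∎
  where
  β = + (suc n !) / 1
  G = λ m → (+ (suc n C m) / 1) * ((+ (m !) / 1) * a m) * ((+ ((n ∸ m ℕ.+ 1) !) / 1) * b (n ∸ m ℕ.+ 1))

  term : ∀ m → m < n → G m ≡ β * (a m * b (suc n ∸ m))
  term m m<n = trans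
    (cong (λ j → (+ (suc n C m) / 1) * ((+ (m !) / 1) * a m) * ((+ (j !) / 1) * b j)) n∸m+1≡1+n∸m)
    (binomial-*-factorials (ℕₚ.m≤n⇒m≤1+n m≤n) (a m) (b (suc n ∸ m)))
    where
    m≤n = ℕₚ.<⇒≤ m<n
    n∸m+1≡1+n∸m : n ∸ m ℕ.+ 1 ≡ suc n ∸ m
    n∸m+1≡1+n∸m = trans (ℕₚ.+-comm (n ∸ m) 1) (sym (ℕₚ.+-∸-assoc 1 m≤n))

recurrence-scalar : ∀ N n →
  (+ (2 ℕ.+ N) / (suc n ℕ.* suc N)) * (+ (suc n !) / 1) * (+ suc N / (2 ℕ.+ N)) ≡ + (n !) / 1
recurrence-scalar N n = begin
  (+ (2 ℕ.+ N) / (suc n ℕ.* suc N)) * (+ (suc n !) / 1) * (+ suc N / (2 ℕ.+ N))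
    ≡⟨ cong (_* (+ suc N / (2 ℕ.+ N))) (*-/ (2 ℕ.+ N) (suc n !) (suc n ℕ.* suc N) 1) ⟩
  (+ ((2 ℕ.+ N) ℕ.* suc n !) / (suc n ℕ.* suc N ℕ.* 1)) * (+ suc N / (2 ℕ.+ N))
    ≡⟨ *-/ ((2 ℕ.+ N) ℕ.* suc n !) (suc N) (suc n ℕ.* suc N ℕ.* 1) (2 ℕ.+ N) ⟩
  + ((2 ℕ.+ N) ℕ.* suc n ! ℕ.* suc N) / (suc n ℕ.* suc N ℕ.* 1 ℕ.* (2 ℕ.+ N))
    ≡⟨ /-cross ((2 ℕ.+ N) ℕ.* suc n ! ℕ.* suc N) (n !) (suc n ℕ.* suc N ℕ.* 1 ℕ.* (2 ℕ.+ N)) 1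
         (solve 4 (λ a b m f → a :* (m :* f) :* b :* con 1 := f :* (m :* b :* con 1 :* a)) refl (2 ℕ.+ N) (suc N) (suc n) (n !)) ⟩
  + (n !) / 1
    ∎
  where open ℕ-Solver

lemma2 : ∀ (N n : ℕ) (h : 2 ≤ N) →
    c N n ≡ c (N ∸ 1) n
      - (+ N / (suc n ℕ.* (N ∸ 1))) {{denom-nz h n}}
        * Σ< n (λ m → (+ (suc n C m) / 1) * c N m * c (N ∸ 1) (n ∸ m ℕ.+ 1))
lemma2 (suc (suc p)) n (s≤s (s≤s _)) = begin
  γ * A n
    ≡⟨ solve 3 (λ γ a b → γ :* a := γ :* b :- γ :* (b :- a)) refl γ (A n) (B n) ⟩
  γ * B n - γ * (B n - A n)
    ≡˘⟨ cong (λ t → γ * B n - t * (B n - A n)) (recurrence-scalar p n) ⟩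
  γ * B n - α * β * k * (B n - A n)
    ≡⟨ solve 6 (λ γ a b α β k → γ :* b :- α :* β :* k :* (b :- a) := γ :* b :- α :* (β :* (k :* (b :- a))))
               refl γ (A n) (B n) α β k ⟩
  γ * B n - α * (β * (k * (B n - A n)))
    ≡˘⟨ cong (λ t → γ * B n - α * (β * t)) (sumUpTo-invCoeff-⋆-invCoeff {k = k} refl refl (F-suc p) n) ⟩
  γ * B n - α * (β * sumUpTo (λ m → A m * B (suc n ∸ m)) n)
    ≡˘⟨ cong (λ t → γ * B n - α * t) (Σ<-binomial-factorials n A B) ⟩
  γ * B n - α * Σ< n G ∎
  where
  open ℚ-Solver
  A = invCoeff (F (2 ℕ.+ p))
  B = invCoeff (F (suc p))
  α = + (2 ℕ.+ p) / (suc n ℕ.* suc p)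
  β = + (suc n !) / 1
  γ = + (n !) / 1
  k = + suc p / (2 ℕ.+ p)
  G = λ m → (+ (suc n C m) / 1) * c (2 ℕ.+ p) m * c (suc p) (n ∸ m ℕ.+ 1)
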